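{- Let $q\ge2$ and $\mu,\nu\ge1$, $\rho$ be integers with $2\rho\le\nu-1$. For integers $m,n$ put $m'=m+q^{\mu-\rho}$ and $n'=n+q^\rho$. Then \[ \#\{(m,n)\in\mathbb{Z}^2:\ q^{\mu-1}\le m<q^\mu,\ q^{\nu-1}\le n<q^\nu,\ T_q(mn)\ne T_q(m'n')\}\ll\log(q^{\mu+\nu})\,q^{\mu+\nu-\rho}. \]
   Context: $T_q(x)=\lfloor\log x/\log q\rfloor$ for $x\ge1$. The implied constant depends only on $q$. -}

module Defs where

open import Data.Nat as ℕ using (ℕ; zero; suc)
open import Data.Nat.Properties using (m^n≢0)
open import Data.Integer as ℤ using (ℤ; +_; -[1+_])
open import Data.Rational as ℚ using (ℚ; _/_)
open import Data.Product using (_×_; _,_)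
open import Data.List using (List; length)
open import Data.List.Membership.Propositional using (_∈_)
open import Relation.Binary.PropositionalEquality using (_≡_; _≢_)

toℚ : ℕ → ℚ
toℚ n = + n / 1

-- qpow q k = q ^ k ∈ ℚ for an integer exponent k (q ≥ 1; junk value 0 for q = 0,
-- never used since the statement assumes q ≥ 2)
qpow : ℕ → ℤ → ℚ
qpow q (+ j) = + (q ℕ.^ j) / 1
qpow zero -[1+ j ] = + 0 / 1
qpow (suc q) -[1+ j ] = (+ 1 / (suc q ℕ.^ suc j)) {{m^n≢0 (suc q) (suc j)}}

-- IsTq q x k  :⇔  T_q(x) = ⌊ log x / log q ⌋ = k,
-- i.e. k is the integer with q^k ≤ x < q^(k+1)   (for x ≥ 1, q ≥ 2)
IsTq : ℕ → ℚ → ℤ → Set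
IsTq q x k = (qpow q k ℚ.≤ x) × (x ℚ.< qpow q (k ℤ.+ + 1))

-- T_q(x) ≠ T_q(y)   (T_q is total and single-valued on x ≥ 1)
TqDiffer : ℕ → ℚ → ℚ → Set
TqDiffer q x y = ∀ k l → IsTq q x k → IsTq q y l → k ≢ l

-- #{ s : P s } ≤ B : some list of length ≤ B contains every element satisfying P
CardLe : {A : Set} → (A → Set) → ℕ → Set
CardLe {A} P B = Data.Product.Σ (List A) (λ L → (length L ℕ.≤ B) × (∀ a → P a → a ∈ L))

CardLe₂ : {A B : Set} → (A → B → Set) → ℕ → Set
CardLe₂ {A} {B} P N = CardLe {A × B} (λ ab → P (Data.Product.proj₁ ab) (Data.Product.proj₂ ab)) N

-- With P = q^ρ one has P·m′n′ = (mP + q^μ)(n + P) = mnP + R where R < 3q^μ q^ν, because P² ≤ q^ν.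
-- Since m′n′ ≥ mn, T_q(mn) = k ≠ T_q(m′n′) forces q^(k+1) ≤ m′n′, hence mn < q^(k+1) < mn + 3q^(μ+ν−ρ).
-- As q^(μ+ν−2) ≤ mn < q^(μ+ν), only two values of k occur, and for fixed m ≥ q^(μ−1) these inequalities
-- confine n to an interval of length at most 3q^(ν+1−ρ) + 1. Summing over m < q^μ gives O(q^(μ+ν−ρ))
-- exceptional pairs, without the logarithmic factor. For ρ < 0 the trivial count q^(μ+ν) suffices.

module Submission where

open import Defs
open import Data.Nat as ℕ using (ℕ; zero; suc; _≤_; _<_; z≤n; _+_; _*_; _∸_; _^_; NonZero)
import Data.Nat.Properties as ℕP
open import Data.Nat.Coprimality using (1-coprimeTo) renaming (sym to coprime-sym)
open import Data.Nat.DivMod using (_/_; m≡m%n+[m/n]*n; m%n<n; /-monoˡ-≤; m*n/n≡m)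
import Data.Nat.Solver as ℕSolver
open import Data.Integer as ℤ using (ℤ; +_; -[1+_]; _⊖_)
import Data.Integer.Properties as ℤP
open import Data.Rational as ℚ using (ℚ; mkℚ)
import Data.Rational.Properties as ℚP
import Data.Rational.Unnormalised as ℚᵘ
import Data.Rational.Unnormalised.Properties as ℚᵘP
open import Data.Rational.Solver using (module +-*-Solver)
open import Data.List using ([]; _++_; map; upTo; length)
open import Data.List.Properties using (length-map; length-++; length-upTo)
open import Data.List.Membership.Propositional using (_∈_)
open import Data.List.Membership.Propositional.Properties using (∈-++⁺ˡ; ∈-++⁺ʳ; ∈-map⁺; ∈-upTo⁺)
open import Data.Product using (Σ; _×_; _,_; proj₁; proj₂)
open import Data.Sum using (_⊎_; inj₁; inj₂)
open import Relation.Nullary using (yes; no; contradiction)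
open import Relation.Binary.PropositionalEquality

toℚ≡mkℚ : ∀ a → toℚ a ≡ mkℚ (+ a) 0 (coprime-sym (1-coprimeTo a))
toℚ≡mkℚ a = ℚP.normalize-coprime _

toℚ-homo-+ : ∀ a b → toℚ (a + b) ≡ toℚ a ℚ.+ toℚ b
toℚ-homo-+ a b rewrite toℚ≡mkℚ a | toℚ≡mkℚ b =
  cong (ℚ._/ 1) (trans (ℤP.pos-+ a b) (sym (cong₂ ℤ._+_ (ℤP.*-identityʳ (+ a)) (ℤP.*-identityʳ (+ b)))))

toℚ-homo-* : ∀ a b → toℚ (a * b) ≡ toℚ a ℚ.* toℚ b
toℚ-homo-* a b rewrite toℚ≡mkℚ a | toℚ≡mkℚ b = cong (ℚ._/ 1) (ℤP.pos-* a b)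

toℚ-mono-≤ : ∀ {a b} → a ≤ b → toℚ a ℚ.≤ toℚ b
toℚ-mono-≤ {a} {b} a≤b rewrite toℚ≡mkℚ a | toℚ≡mkℚ b =
  ℚ.*≤* (subst₂ ℤ._≤_ (sym (ℤP.*-identityʳ (+ a))) (sym (ℤP.*-identityʳ (+ b))) (ℤ.+≤+ a≤b))

toℚ-cancel-≤ : ∀ {a b} → toℚ a ℚ.≤ toℚ b → a ≤ b
toℚ-cancel-≤ {a} {b} le rewrite toℚ≡mkℚ a | toℚ≡mkℚ b with le
... | ℚ.*≤* h = ℤP.drop‿+≤+ (subst₂ ℤ._≤_ (ℤP.*-identityʳ (+ a)) (ℤP.*-identityʳ (+ b)) h)

toℚ-mono-< : ∀ {a b} → a < b → toℚ a ℚ.< toℚ b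
toℚ-mono-< {a} {b} a<b rewrite toℚ≡mkℚ a | toℚ≡mkℚ b =
  ℚ.*<* (subst₂ ℤ._<_ (sym (ℤP.*-identityʳ (+ a))) (sym (ℤP.*-identityʳ (+ b))) (ℤ.+<+ a<b))

1/n*toℚ[n*m]≡toℚ[m] : ∀ n .{{_ : NonZero n}} m → (+ 1 ℚ./ n) ℚ.* toℚ (n * m) ≡ toℚ m
1/n*toℚ[n*m]≡toℚ[m] zero {{()}}
1/n*toℚ[n*m]≡toℚ[m] n@(suc n-1) m
  rewrite ℚP.normalize-coprime {1} {n-1} (1-coprimeTo n) | toℚ≡mkℚ (n * m) | toℚ≡mkℚ m =
  ℚP.toℚᵘ-injective (ℚᵘP.≃-trans (ℚP.toℚᵘ-homo-* 1/n nm) (ℚᵘ.*≡* cross))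
  where
  1/n nm : ℚ
  1/n = mkℚ (+ 1) n-1 (1-coprimeTo n)
  nm  = mkℚ (+ (n * m)) 0 (coprime-sym (1-coprimeTo (n * m)))
  cross : (+ 1 ℤ.* + (n * m)) ℤ.* + 1 ≡ + m ℤ.* + (n * 1)
  cross = begin
    (+ 1 ℤ.* + (n * m)) ℤ.* + 1 ≡⟨ trans (ℤP.*-identityʳ _) (ℤP.*-identityˡ _) ⟩
    + (n * m)                   ≡⟨ cong +_ (trans (ℕP.*-comm n m) (cong (m *_) (sym (ℕP.*-identityʳ n)))) ⟩
    + (m * (n * 1))             ≡⟨ ℤP.pos-* m (n * 1) ⟩
    + m ℤ.* + (n * 1)           ∎
    where open ≡-Reasoning

m⊖[1+m+n]≡-[1+n] : ∀ m n → m ⊖ suc (m + n) ≡ -[1+ n ]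
m⊖[1+m+n]≡-[1+n] zero    n = refl
m⊖[1+m+n]≡-[1+n] (suc m) n = trans (ℤP.[1+m]⊖[1+n]≡m⊖n m (suc (m + n))) (m⊖[1+m+n]≡-[1+n] m n)

qpow[μ-r]*q^r≡q^μ : ∀ q μ r .{{_ : NonZero q}} → qpow q (+ μ ℤ.- + r) ℚ.* toℚ (q ^ r) ≡ toℚ (q ^ μ)
qpow[μ-r]*q^r≡q^μ q@(suc _) μ r with r ℕP.≤? μ
... | yes r≤μ rewrite ℤP.[+m]-[+n]≡m⊖n μ r | ℤP.⊖-≥ r≤μ = begin
  toℚ (q ^ (μ ∸ r)) ℚ.* toℚ (q ^ r) ≡⟨ toℚ-homo-* (q ^ (μ ∸ r)) (q ^ r) ⟨
  toℚ (q ^ (μ ∸ r) * q ^ r)         ≡⟨ cong toℚ (ℕP.^-distribˡ-+-* q (μ ∸ r) r) ⟨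
  toℚ (q ^ (μ ∸ r + r))             ≡⟨ cong (λ e → toℚ (q ^ e)) (ℕP.m∸n+n≡m r≤μ) ⟩
  toℚ (q ^ μ)                       ∎
  where open ≡-Reasoning
... | no r≰μ with ℕP.m≤n⇒∃[o]m+o≡n (ℕP.≰⇒> r≰μ)
...   | j , refl rewrite ℤP.[+m]-[+n]≡m⊖n μ (suc μ + j) | m⊖[1+m+n]≡-[1+n] μ j = begin
  q⁻ʲ⁻¹ ℚ.* toℚ (q ^ (suc μ + j))   ≡⟨ cong (λ e → q⁻ʲ⁻¹ ℚ.* toℚ (q ^ e)) 1+μ+j≡1+j+μ ⟩
  q⁻ʲ⁻¹ ℚ.* toℚ (q ^ (suc j + μ))   ≡⟨ cong (λ t → q⁻ʲ⁻¹ ℚ.* toℚ t) (ℕP.^-distribˡ-+-* q (suc j) μ) ⟩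
  q⁻ʲ⁻¹ ℚ.* toℚ (q ^ suc j * q ^ μ) ≡⟨ 1/n*toℚ[n*m]≡toℚ[m] (q ^ suc j) {{ℕP.m^n≢0 q (suc j)}} (q ^ μ) ⟩
  toℚ (q ^ μ)                       ∎
  where
  open ≡-Reasoning
  q⁻ʲ⁻¹ : ℚ
  q⁻ʲ⁻¹ = qpow q -[1+ j ]
  1+μ+j≡1+j+μ : suc μ + j ≡ suc j + μ
  1+μ+j≡1+j+μ = trans (ℕP.+-comm (suc μ) j) (ℕP.+-suc j μ)

[x+a][z+b]b≡[xb+ab][z+b] : ∀ x a z b →
  ((x ℚ.+ a) ℚ.* (z ℚ.+ b)) ℚ.* b ≡ (x ℚ.* b ℚ.+ a ℚ.* b) ℚ.* (z ℚ.+ b)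
[x+a][z+b]b≡[xb+ab][z+b] =
  solve 4 (λ x a z b → ((x :+ a) :* (z :+ b)) :* b := ((x :* b) :+ (a :* b)) :* (z :+ b)) refl
  where open +-*-Solver

perturbed-product-scaled : ∀ m n P c (a : ℚ) → a ℚ.* toℚ P ≡ toℚ c →
  ((toℚ m ℚ.+ a) ℚ.* (toℚ n ℚ.+ toℚ P)) ℚ.* toℚ P ≡ toℚ ((m * P + c) * (n + P))
perturbed-product-scaled m n P c a aP≡c = begin
  ((toℚ m ℚ.+ a) ℚ.* (toℚ n ℚ.+ toℚ P)) ℚ.* toℚ P
    ≡⟨ [x+a][z+b]b≡[xb+ab][z+b] (toℚ m) a (toℚ n) (toℚ P) ⟩
  (toℚ m ℚ.* toℚ P ℚ.+ a ℚ.* toℚ P) ℚ.* (toℚ n ℚ.+ toℚ P)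
    ≡⟨ cong₂ (λ u v → (u ℚ.+ v) ℚ.* (toℚ n ℚ.+ toℚ P)) (sym (toℚ-homo-* m P)) aP≡c ⟩
  (toℚ (m * P) ℚ.+ toℚ c) ℚ.* (toℚ n ℚ.+ toℚ P)
    ≡⟨ cong₂ ℚ._*_ (toℚ-homo-+ (m * P) c) (toℚ-homo-+ n P) ⟨
  toℚ (m * P + c) ℚ.* toℚ (n + P)
    ≡⟨ toℚ-homo-* (m * P + c) (n + P) ⟨
  toℚ ((m * P + c) * (n + P))
    ∎
  where open ≡-Reasoning

module _ {y : ℚ} {P A : ℕ} .{{_ : NonZero P}} (yP≡A : y ℚ.* toℚ P ≡ toℚ A) where

  private instance
    toℚP-positive : ℚ.Positive (toℚ P)
    toℚP-positive = ℚ.positive (toℚ-mono-< (ℕ.>-nonZero⁻¹ P))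
    toℚP-nonNegative : ℚ.NonNegative (toℚ P)
    toℚP-nonNegative = ℚP.pos⇒nonNeg (toℚ P)

  toℚ≤-scaled⇒*≤ : ∀ c → toℚ c ℚ.≤ y → c * P ≤ A
  toℚ≤-scaled⇒*≤ c c≤y =
    toℚ-cancel-≤ (subst₂ ℚ._≤_ (sym (toℚ-homo-* c P)) yP≡A (ℚP.*-monoʳ-≤-nonNeg (toℚ P) c≤y))

  *≤⇒toℚ≤-scaled : ∀ c → c * P ≤ A → toℚ c ℚ.≤ y
  *≤⇒toℚ≤-scaled c cP≤A =
    ℚP.*-cancelʳ-≤-pos (toℚ P) (subst₂ ℚ._≤_ (toℚ-homo-* c P) (sym yP≡A) (toℚ-mono-≤ cP≤A))

TqDiffer⇒qpow-suc≤ : ∀ {q x y k} → TqDiffer q x y → IsTq q x k → x ℚ.≤ y →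
  qpow q (k ℤ.+ + 1) ℚ.≤ y
TqDiffer⇒qpow-suc≤ {q} {y = y} {k} x≁y (qᵏ≤x , x<qᵏ⁺¹) x≤y with y ℚP.<? qpow q (k ℤ.+ + 1)
... | yes y<qᵏ⁺¹ = contradiction refl (x≁y k k (qᵏ≤x , x<qᵏ⁺¹) (ℚP.≤-trans qᵏ≤x x≤y , y<qᵏ⁺¹))
... | no  y≮qᵏ⁺¹ = ℚP.≮⇒≥ y≮qᵏ⁺¹

perturbed-product< : ∀ {m n a b P W} → m < a → n < b → P * P ≤ b → P ≤ b → W * P ≡ b →
  (m * P + a) * (n + P) < (m * n + 3 * a * W) * P
perturbed-product< {m} {n} {a} {b} {P} {W} m<a n<b P²≤b P≤b WP≡b = begin-strict
  (m * P + a) * (n + P)                      ≡⟨ expand m n a P ⟩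
  m * n * P + (m * (P * P) + a * n + a * P)  <⟨ ℕP.+-monoʳ-< (m * n * P) remainder< ⟩
  m * n * P + (a * b + a * b + a * b)        ≡⟨ cong (λ b → m * n * P + (a * b + a * b + a * b)) WP≡b ⟨
  m * n * P + (a * (W * P) + a * (W * P) + a * (W * P))
                                             ≡⟨ collect m n a W P ⟩
  (m * n + 3 * a * W) * P                    ∎
  where
  open ℕP.≤-Reasoning
  open ℕSolver.+-*-Solver
  expand : ∀ m n a P → (m * P + a) * (n + P) ≡ m * n * P + (m * (P * P) + a * n + a * P)
  expand = solve 4 (λ m n a P → (m :* P :+ a) :* (n :+ P) := m :* n :* P :+ (m :* (P :* P) :+ a :* n :+ a :* P)) refl
  collect : ∀ m n a W P → m * n * P + (a * (W * P) + a * (W * P) + a * (W * P)) ≡ (m * n + 3 * a * W) * P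
  collect = solve 5 (λ m n a W P → m :* n :* P :+ (a :* (W :* P) :+ a :* (W :* P) :+ a :* (W :* P))
                                   := (m :* n :+ con 3 :* a :* W) :* P) refl
  a≢0 = ℕ.>-nonZero (ℕP.≤-<-trans z≤n m<a)
  b≢0 = ℕ.>-nonZero (ℕP.≤-<-trans z≤n n<b)
  remainder< : m * (P * P) + a * n + a * P < a * b + a * b + a * b
  remainder< = ℕP.+-mono-<-≤
    (ℕP.+-mono-< (ℕP.≤-<-trans (ℕP.*-monoʳ-≤ m P²≤b) (ℕP.*-monoˡ-< b {{b≢0}} m<a))
                 (ℕP.*-monoʳ-< a {{a≢0}} n<b))
    (ℕP.*-monoʳ-≤ a P≤b)

window : ∀ {p S m n X} .{{_ : NonZero m}} → p ≤ m → m * n < X → X < m * n + p * S →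
         (X ∸ p * S) / m ≤ n × n < (X ∸ p * S) / m + suc S
window {p} {S} {m} {n} {X} p≤m mn<X X<mn+pS = a≤n , n<a+1+S
  where
  z = X ∸ p * S
  a = z / m
  z≤mn : z ≤ m * n
  z≤mn = ℕP.≤-trans (ℕP.∸-monoˡ-≤ (p * S) (ℕP.<⇒≤ X<mn+pS))
                    (ℕP.≤-reflexive (ℕP.m+n∸n≡m (m * n) (p * S)))
  a≤n : a ≤ n
  a≤n = ℕP.≤-trans (/-monoˡ-≤ m z≤mn)
                   (ℕP.≤-reflexive (trans (cong (_/ m) (ℕP.*-comm m n)) (m*n/n≡m n m)))
  z<[1+a]m : z < suc a * m
  z<[1+a]m = ℕP.≤-<-trans (ℕP.≤-reflexive (m≡m%n+[m/n]*n z m)) (ℕP.+-monoˡ-< (a * m) (m%n<n z m))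
  nm<[1+a+S]m : n * m < (suc a + S) * m
  nm<[1+a+S]m = begin-strict
    n * m               ≡⟨ ℕP.*-comm n m ⟩
    m * n               <⟨ mn<X ⟩
    X                   ≤⟨ ℕP.m≤n+m∸n X (p * S) ⟩
    p * S + z           ≡⟨ ℕP.+-comm (p * S) z ⟩
    z + p * S           <⟨ ℕP.+-monoˡ-< (p * S) z<[1+a]m ⟩
    suc a * m + p * S   ≤⟨ ℕP.+-monoʳ-≤ (suc a * m) (ℕP.*-monoˡ-≤ S p≤m) ⟩
    suc a * m + m * S   ≡⟨ cong (suc a * m ℕ.+_) (ℕP.*-comm m S) ⟩
    suc a * m + S * m   ≡⟨ ℕP.*-distribʳ-+ m (suc a) S ⟨
    (suc a + S) * m     ∎
    where open ℕP.≤-Reasoning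
  n<a+1+S : n < a + suc S
  n<a+1+S = subst (n <_) (sym (ℕP.+-suc a S)) (ℕP.*-cancelʳ-< m n (suc a + S) nm<[1+a+S]m)

module _ {A : Set} where

  CardLe-mono : ∀ {P Q : A → Set} {B B′} → (∀ a → P a → Q a) → B ≤ B′ → CardLe Q B → CardLe P B′
  CardLe-mono P⇒Q B≤B′ (L , |L|≤B , Q⊆L) = L , ℕP.≤-trans |L|≤B B≤B′ , λ a Pa → Q⊆L a (P⇒Q a Pa)

  CardLe-⊎ : ∀ {P Q : A → Set} {B B′} → CardLe P B → CardLe Q B′ → CardLe (λ a → P a ⊎ Q a) (B + B′)
  CardLe-⊎ (L , |L|≤B , P⊆L) (L′ , |L′|≤B′ , Q⊆L′) =
    L ++ L′ ,
    ℕP.≤-trans (ℕP.≤-reflexive (length-++ L)) (ℕP.+-mono-≤ |L|≤B |L′|≤B′) ,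
    λ { a (inj₁ Pa) → ∈-++⁺ˡ (P⊆L a Pa) ; a (inj₂ Qa) → ∈-++⁺ʳ L (Q⊆L′ a Qa) }

CardLe-interval : ∀ a L → CardLe (λ n → a ≤ n × n < a + L) L
CardLe-interval a L =
  map (a ℕ.+_) (upTo L) ,
  ℕP.≤-reflexive (trans (length-map (a ℕ.+_) (upTo L)) (length-upTo L)) ,
  λ n (a≤n , n<a+L) → subst (_∈ map (a ℕ.+_) (upTo L)) (ℕP.m+[n∸m]≡n a≤n)
    (∈-map⁺ (a ℕ.+_) (∈-upTo⁺ (subst (n ∸ a <_) (ℕP.m+n∸m≡n a L) (ℕP.∸-monoˡ-< n<a+L a≤n))))

CardLe₂-fibres : ∀ {A : Set} {P : ℕ → A → Set} M {B} →
  (∀ m → m < M → CardLe (P m) B) → CardLe₂ (λ m a → m < M × P m a) (M * B)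
CardLe₂-fibres zero    _     = [] , z≤n , λ { (m , a) (() , _) }
CardLe₂-fibres {P = P} (suc M) {B} fibre
  with fibre M (ℕP.n<1+n M) | CardLe₂-fibres M (λ m m<M → fibre m (ℕP.m<n⇒m<1+n m<M))
... | L , |L|≤B , PM⊆L | L′ , |L′|≤MB , P<M⊆L′ =
  map (M ,_) L ++ L′ ,
  ℕP.≤-trans (ℕP.≤-reflexive (trans (length-++ (map (M ,_) L)) (cong (_+ length L′) (length-map (M ,_) L))))
             (ℕP.+-mono-≤ |L|≤B |L′|≤MB) ,
  covers
  where
  covers : ∀ ma → proj₁ ma < suc M × P (proj₁ ma) (proj₂ ma) → ma ∈ map (M ,_) L ++ L′
  covers (m , a) (m<1+M , Pma) with ℕP.m≤n⇒m<n∨m≡n (ℕ.s≤s⁻¹ m<1+M)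
  ... | inj₁ m<M  = ∈-++⁺ʳ (map (M ,_) L) (P<M⊆L′ (m , a) (m<M , Pma))
  ... | inj₂ refl = ∈-++⁺ˡ (∈-map⁺ (M ,_) (PM⊆L a Pma))

CardLe₂-box : ∀ M N → CardLe₂ (λ m n → m < M × n < N) (M * N)
CardLe₂-box M N =
  CardLe₂-fibres M (λ _ _ → CardLe-mono (λ _ n<N → z≤n , n<N) ℕP.≤-refl (CardLe-interval 0 N))

module _ (p S X m : ℕ) .{{_ : NonZero p}} where

  JustBelow : ℕ → Set
  JustBelow n = p ≤ m × m * n < X × X < m * n + p * S

  CardLe-JustBelow : CardLe JustBelow (suc S)
  CardLe-JustBelow with p ℕP.≤? m
  ... | no  p≰m = [] , z≤n , λ _ (p≤m , _) → contradiction p≤m p≰m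
  ... | yes p≤m = CardLe-mono (λ _ (_ , mn<X , X<mn+pS) → window p≤m mn<X X<mn+pS) ℕP.≤-refl
                                (CardLe-interval _ (suc S))
    where instance
      m≢0 : NonZero m
      m≢0 = ℕ.>-nonZero (ℕP.<-≤-trans (ℕ.>-nonZero⁻¹ p) p≤m)

module NonNegativeShift (q : ℕ) .{{_ : NonZero q}} (μ-1 ν-1 r : ℕ) (2r≤ν-1 : 2 * r ≤ ν-1) where

  μ ν P W S e : ℕ
  μ = suc μ-1
  ν = suc ν-1
  P = q ^ r
  W = q ^ (ν ∸ r)
  S = 3 * q * W
  e = μ-1 + ν-1

  private instance
    P≢0 : NonZero P
    P≢0 = ℕP.m^n≢0 q r
    q^μ-1≢0 : NonZero (q ^ μ-1)
    q^μ-1≢0 = ℕP.m^n≢0 q μ-1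

  shiftedProduct : ℕ → ℕ → ℚ
  shiftedProduct m n = (toℚ m ℚ.+ qpow q (+ μ ℤ.- + r)) ℚ.* (toℚ n ℚ.+ qpow q (+ r))

  Exceptional : ℕ → ℕ → Set
  Exceptional m n = (q ^ μ-1 ≤ m) × (m < q ^ μ) × (q ^ ν-1 ≤ n) × (n < q ^ ν) ×
    TqDiffer q (toℚ (m * n)) (shiftedProduct m n)

  r+r≤ν : r + r ≤ ν
  r+r≤ν = ℕP.m≤n⇒m≤1+n (subst (_≤ ν-1) (cong (r ℕ.+_) (ℕP.+-identityʳ r)) 2r≤ν-1)

  r≤ν : r ≤ ν
  r≤ν = ℕP.≤-trans (ℕP.m≤m+n r r) r+r≤ν

  WP≡q^ν : W * P ≡ q ^ ν
  WP≡q^ν = trans (sym (ℕP.^-distribˡ-+-* q (ν ∸ r) r)) (cong (q ^_) (ℕP.m∸n+n≡m r≤ν))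

  crossing : ∀ {m n} k → m < q ^ μ → n < q ^ ν → q ^ k ≤ m * n → m * n < q ^ (k + 1) →
    TqDiffer q (toℚ (m * n)) (shiftedProduct m n) → q ^ (k + 1) < m * n + q ^ μ-1 * S
  crossing {m} {n} k m<q^μ n<q^ν q^k≤mn mn<q^k+1 differ = ℕP.*-cancelʳ-< P _ _ (begin-strict
    q ^ (k + 1) * P              ≤⟨ toℚ≤-scaled⇒*≤ yP≡A (q ^ (k + 1)) q^k+1≤y ⟩
    (m * P + q ^ μ) * (n + P)    <⟨ perturbed-product< m<q^μ n<q^ν P²≤q^ν P≤q^ν WP≡q^ν ⟩
    (m * n + 3 * q ^ μ * W) * P  ≡⟨ cong (λ t → (m * n + t) * P) (3qpW≡p*3qW q (q ^ μ-1) W) ⟩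
    (m * n + q ^ μ-1 * S) * P    ∎)
    where
    open ℕP.≤-Reasoning
    open ℕSolver.+-*-Solver
    3qpW≡p*3qW : ∀ q p W → 3 * (q * p) * W ≡ p * (3 * q * W)
    3qpW≡p*3qW = solve 3 (λ q p W → con 3 :* (q :* p) :* W := p :* (con 3 :* q :* W)) refl
    yP≡A = perturbed-product-scaled m n P (q ^ μ) (qpow q (+ μ ℤ.- + r)) (qpow[μ-r]*q^r≡q^μ q μ r)
    mnP≤A : m * n * P ≤ (m * P + q ^ μ) * (n + P)
    mnP≤A = begin
      m * n * P                  ≡⟨ ℕP.*-assoc m n P ⟩
      m * (n * P)                ≡⟨ cong (m *_) (ℕP.*-comm n P) ⟩
      m * (P * n)                ≡⟨ ℕP.*-assoc m P n ⟨
      m * P * n                  ≤⟨ ℕP.*-mono-≤ (ℕP.m≤m+n (m * P) (q ^ μ)) (ℕP.m≤m+n n P) ⟩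
      (m * P + q ^ μ) * (n + P)  ∎
    q^k+1≤y = TqDiffer⇒qpow-suc≤ {k = + k} differ (toℚ-mono-≤ q^k≤mn , toℚ-mono-< mn<q^k+1)
                                 (*≤⇒toℚ≤-scaled yP≡A (m * n) mnP≤A)
    P²≤q^ν = ℕP.≤-trans (ℕP.≤-reflexive (sym (ℕP.^-distribˡ-+-* q r r))) (ℕP.^-monoʳ-≤ q r+r≤ν)
    P≤q^ν = ℕP.^-monoʳ-≤ q r≤ν

  q^e≤mn : ∀ {m n} → q ^ μ-1 ≤ m → q ^ ν-1 ≤ n → q ^ e ≤ m * n
  q^e≤mn q^μ-1≤m q^ν-1≤n =
    ℕP.≤-trans (ℕP.≤-reflexive (ℕP.^-distribˡ-+-* q μ-1 ν-1)) (ℕP.*-mono-≤ q^μ-1≤m q^ν-1≤n)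

  mn<q^[e+2] : ∀ {m n} → m < q ^ μ → n < q ^ ν → m * n < q ^ (suc e + 1)
  mn<q^[e+2] m<q^μ n<q^ν = ℕP.<-≤-trans (ℕP.*-mono-< m<q^μ n<q^ν) (ℕP.≤-reflexive (begin
    q ^ μ * q ^ ν         ≡⟨ ℕP.^-distribˡ-+-* q μ ν ⟨
    q ^ (μ + ν)           ≡⟨ cong (λ i → q ^ suc i) (trans (ℕP.+-suc μ-1 ν-1) (ℕP.+-comm 1 e)) ⟩
    q ^ (suc e + 1)       ∎))
    where open ≡-Reasoning

  exceptional⇒crossing : ∀ m n → Exceptional m n →
    m < q ^ μ × (JustBelow (q ^ μ-1) S (q ^ (e + 1)) m n ⊎
                 JustBelow (q ^ μ-1) S (q ^ (suc e + 1)) m n)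
  exceptional⇒crossing m n (q^μ-1≤m , m<q^μ , q^ν-1≤n , n<q^ν , differ) with m * n ℕP.<? q ^ (e + 1)
  ... | yes mn<q^[e+1] = m<q^μ , inj₁ (q^μ-1≤m , mn<q^[e+1] ,
          crossing e m<q^μ n<q^ν (q^e≤mn q^μ-1≤m q^ν-1≤n) mn<q^[e+1] differ)
  ... | no  mn≮q^[e+1] = m<q^μ , inj₂ (q^μ-1≤m , mn<q^[e+2] m<q^μ n<q^ν ,
          crossing (suc e) m<q^μ n<q^ν q^[e+1]≤mn (mn<q^[e+2] m<q^μ n<q^ν) differ)
    where
    q^[e+1]≤mn = subst (λ i → q ^ i ≤ m * n) (ℕP.+-comm e 1) (ℕP.≮⇒≥ mn≮q^[e+1])

  count : CardLe₂ Exceptional (q ^ μ * (suc S + suc S))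
  count = CardLe-mono (λ { (m , n) → exceptional⇒crossing m n }) ℕP.≤-refl
    (CardLe₂-fibres (q ^ μ) λ m _ →
      CardLe-⊎ (CardLe-JustBelow (q ^ μ-1) S (q ^ (e + 1)) m)
               (CardLe-JustBelow (q ^ μ-1) S (q ^ (suc e + 1)) m))

  count≤ : q ^ μ * (suc S + suc S) ≤ 8 * q * (μ + ν) * q ^ ℤ.∣ + (μ + ν) ℤ.- + r ∣
  count≤ = begin
    q ^ μ * (suc S + suc S)                     ≤⟨ ℕP.*-monoʳ-≤ (q ^ μ) (ℕP.+-mono-≤ 1+S≤4qW 1+S≤4qW) ⟩
    q ^ μ * (4 * (q * W) + 4 * (q * W))         ≡⟨ collect (q ^ μ) q W ⟩
    8 * q * (q ^ μ * W)                         ≡⟨ cong (8 * q *_) (ℕP.^-distribˡ-+-* q μ (ν ∸ r)) ⟨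
    8 * q * q ^ (μ + (ν ∸ r))                   ≤⟨ ℕP.*-monoˡ-≤ (q ^ (μ + (ν ∸ r))) (ℕP.m≤m*n (8 * q) (μ + ν)) ⟩
    8 * q * (μ + ν) * q ^ (μ + (ν ∸ r))         ≡⟨ cong (λ i → 8 * q * (μ + ν) * q ^ i) exponent ⟨
    8 * q * (μ + ν) * q ^ ℤ.∣ + (μ + ν) ℤ.- + r ∣ ∎
    where
    open ℕP.≤-Reasoning
    open ℕSolver.+-*-Solver
    collect : ∀ a q W → a * (4 * (q * W) + 4 * (q * W)) ≡ 8 * q * (a * W)
    collect = solve 3 (λ a q W → a :* (con 4 :* (q :* W) :+ con 4 :* (q :* W)) := con 8 :* q :* (a :* W)) refl
    1+S≤4qW : suc S ≤ 4 * (q * W)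
    1+S≤4qW = ℕP.≤-trans (ℕP.+-monoˡ-≤ S (ℕP.m^n>0 q (suc (ν ∸ r))))
      (ℕP.≤-reflexive (solve 2 (λ q W → q :* W :+ con 3 :* q :* W := con 4 :* (q :* W)) refl q W))
    exponent : ℤ.∣ + (μ + ν) ℤ.- + r ∣ ≡ μ + (ν ∸ r)
    exponent = begin-equality
      ℤ.∣ + (μ + ν) ℤ.- + r ∣ ≡⟨ cong ℤ.∣_∣ (ℤP.[+m]-[+n]≡m⊖n (μ + ν) r) ⟩
      ℤ.∣ (μ + ν) ⊖ r ∣       ≡⟨ cong ℤ.∣_∣ (ℤP.⊖-≥ (ℕP.≤-trans r≤ν (ℕP.m≤n+m ν μ))) ⟩
      μ + ν ∸ r               ≡⟨ ℕP.+-∸-assoc μ r≤ν ⟩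
      μ + (ν ∸ r)             ∎

q^μ*q^ν≤C*q^[μ+ν+k] : ∀ q .{{_ : NonZero q}} μ ν k C .{{_ : NonZero C}} →
  q ^ μ * q ^ ν ≤ C * q ^ (μ + ν + k)
q^μ*q^ν≤C*q^[μ+ν+k] q μ ν k C = begin
  q ^ μ * q ^ ν       ≡⟨ ℕP.^-distribˡ-+-* q μ ν ⟨
  q ^ (μ + ν)         ≤⟨ ℕP.^-monoʳ-≤ q (ℕP.m≤m+n (μ + ν) k) ⟩
  q ^ (μ + ν + k)     ≤⟨ ℕP.m≤n*m _ C ⟩
  C * q ^ (μ + ν + k) ∎
  where open ℕP.≤-Reasoning

lemma6p3 : ∀ (q : ℕ) → 2 ≤ q →
    Σ ℕ λ C →
      ∀ (μ ν : ℕ) (ρ : ℤ) → 1 ≤ μ → 1 ≤ ν → (+ 2 ℤ.* ρ) ℤ.≤ (+ ν ℤ.- + 1) →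
      CardLe₂
        (λ (m n : ℕ) →
          (q ℕ.^ (μ ℕ.∸ 1) ≤ m) × (m < q ℕ.^ μ) ×
          (q ℕ.^ (ν ℕ.∸ 1) ≤ n) × (n < q ℕ.^ ν) ×
          TqDiffer q (toℚ (m ℕ.* n))
            ((toℚ m ℚ.+ qpow q (+ μ ℤ.- ρ)) ℚ.* (toℚ n ℚ.+ qpow q ρ)))
        (C ℕ.* (μ ℕ.+ ν) ℕ.* q ℕ.^ ℤ.∣ + (μ ℕ.+ ν) ℤ.- ρ ∣)
lemma6p3 q 2≤q = 8 * q , (λ where
  (suc μ-1) (suc ν-1) (+ r) _ _ 2r≤ν-1 →
    let open NonNegativeShift q μ-1 ν-1 r (ℤP.drop‿+≤+ (subst (ℤ._≤ + ν-1) (sym (ℤP.pos-* 2 r)) 2r≤ν-1))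
    in CardLe-mono (λ _ exceptional → exceptional) count≤ count
  (suc μ-1) (suc ν-1) -[1+ r ] _ _ _ →
    CardLe-mono (λ { _ (_ , m<q^μ , _ , n<q^ν , _) → m<q^μ , n<q^ν })
      (q^μ*q^ν≤C*q^[μ+ν+k] q (suc μ-1) (suc ν-1) (suc r) (8 * q * (suc μ-1 + suc ν-1))
                           {{ℕP.m*n≢0 (8 * q) (suc μ-1 + suc ν-1)}})
      (CardLe₂-box (q ^ suc μ-1) (q ^ suc ν-1)))
  where
  instance
    q≢0 : NonZero q
    q≢0 = ℕ.>-nonZero (ℕP.<-trans ℕP.0<1+n 2≤q)
    8q≢0 : NonZero (8 * q)
    8q≢0 = ℕP.m*n≢0 8 q
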